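{- Let $M$ be a $\varphi$-practical number and let $p$ be a prime with $\gcd(p,M)=1$. Then $pM$ is $\varphi$-practical if and only if $p\le M+2$. Moreover, for every integer $k\ge 2$, $p^kM$ is $\varphi$-practical if and only if $p\le M+1$.
   Context: $\varphi$ denotes Euler's totient function. A positive integer $n$ is $\varphi$-practical if every integer $m$ with $1\le m\le n$ can be written as $m=\sum_{d\in\mathcal D}\varphi(d)$ for some subset $\mathcal D$ of the positive divisors of $n$ (equivalently, $t^n-1$ has a divisor in $\mathbb Z[t]$ of every degree from $1$ to $n$). -}

module Defs where

open import Data.Nat using (ℕ; zero; suc; _≤_)
open import Data.Nat.GCD using (gcd)
open import Data.Nat.Divisibility using (_∣_; _∣?_)
open import Data.Nat.Properties using (_≟_)
open import Data.List using (List; filter; length; map; upTo)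
open import Data.Nat.ListAction using (sum)
open import Data.List.Relation.Binary.Sublist.Propositional using (_⊆_)
open import Data.Product using (Σ; _×_)
open import Relation.Binary.PropositionalEquality using (_≡_)

range1 : ℕ → List ℕ
range1 n = map suc (upTo n)

φ : ℕ → ℕ
φ n = length (filter (λ k → gcd k n ≟ 1) (range1 n))

divisors : ℕ → List ℕ
divisors n = filter (λ d → d ∣? n) (range1 n)

-- n is φ-practical: every m with 1 ≤ m ≤ n is Σ_{d ∈ D} φ(d) for some
-- subset D of the positive divisors of n (a sublist of the duplicate-free list)
φ-practical : ℕ → Set
φ-practical n = (m : ℕ) → 1 ≤ m → m ≤ n →
  Σ (List ℕ) (λ D → D ⊆ divisors n × sum (map φ D) ≡ m)

module Submission where

-- Write p = p′ + 1, so that φ (p^(j+1) d) = p′ p^j φ d whenever p ∤ d.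

open import Defs
open import Data.Nat using (ℕ; zero; suc; _+_; _*_; _^_; _∸_; _≤_; _<_; _≤?_; z≤n; s≤s; NonZero; >-nonZero; nonTrivial⇒n>1)
open import Data.Nat.Properties
open import Algebra.Properties.CommutativeSemigroup +-commutativeSemigroup using () renaming (interchange to +-interchange)
open import Data.Nat.Divisibility
open import Data.Nat.GCD using (gcd; gcd-zeroˡ)
open import Data.Nat.Coprimality using (Coprime; coprime⇒gcd≡1; gcd≡1⇒coprime; coprime-divisor)
import Data.Nat.Coprimality as Coprime
open import Data.Nat.Primality using (Prime; ¬prime[0]; prime⇒irreducible; prime⇒nonZero; prime⇒nonTrivial; productOfPrimes≥1)
open import Data.Nat.Primality.Factorisation using (factorise; PrimeFactorisation)
open import Data.List using (List; []; _∷_; _++_; [_]; filter; length; map; upTo)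
open import Data.List.Properties using (map-++; map-∘; upTo-∷ʳ; filter-accept)
open import Data.Nat.ListAction using (sum; product)
open import Data.Nat.ListAction.Properties using (sum-++; sum-↭)
open import Data.List.Membership.Propositional using (_∈_; find; lose)
open import Data.List.Membership.Propositional.Properties using (∈-map⁺; ∈-map⁻; ∈-upTo⁺; ∈-upTo⁻; ∈-filter⁺; ∈-filter⁻; ∈-++⁺ˡ; ∈-++⁺ʳ; ∈-++⁻)
open import Data.List.Membership.Propositional.Properties.WithK using (unique∧set⇒bag)
open import Data.List.Membership.DecPropositional _≟_ using (_∈?_)
open import Data.List.Relation.Binary.BagAndSetEquality using (∼bag⇒↭)
open import Data.List.Relation.Binary.Permutation.Propositional using (_↭_)
import Data.List.Relation.Binary.Permutation.Propositional.Properties as Perm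
open import Data.List.Relation.Binary.Sublist.Propositional using (_⊆_; []; _∷_; _∷ʳ_)
open import Data.List.Relation.Binary.Sublist.Propositional.Properties using (All-resp-⊆; Any-resp-⊆; filter-⊆)
open import Data.List.Relation.Unary.All using (All; []; _∷_)
open import Data.List.Relation.Unary.Any using (here; there; any?)
open import Data.List.Relation.Unary.AllPairs using ([]; _∷_)
open import Data.List.Relation.Unary.Unique.Propositional using (Unique)
import Data.List.Relation.Unary.Unique.Propositional.Properties as Unique
open import Data.Nat.Tactic.RingSolver using (solve-∀)
open import Data.Product using (Σ; _×_; _,_; proj₁; proj₂)
open import Data.Sum using (_⊎_; inj₁; inj₂)
open import Data.Empty using (⊥; ⊥-elim)
open import Function using (_∘_)
open import Function.Bundles using (_⇔_; mk⇔)
open import Relation.Nullary using (¬_; yes; no; ¬?)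
open import Relation.Unary using (Decidable)
open import Relation.Binary.PropositionalEquality hiding ([_])

sumTo : (ℕ → ℕ) → ℕ → ℕ
sumTo g n = sum (map g (range1 n))

sumTo-suc : ∀ g n → sumTo g (suc n) ≡ sumTo g n + g (suc n)
sumTo-suc g n = begin
  sum (map g (map suc (upTo (suc n))))
    ≡⟨ cong (λ l → sum (map g (map suc l))) (sym (upTo-∷ʳ n)) ⟩
  sum (map g (map suc (upTo n ++ [ n ])))
    ≡⟨ cong (λ l → sum (map g l)) (map-++ suc (upTo n) [ n ]) ⟩
  sum (map g (map suc (upTo n) ++ [ suc n ]))
    ≡⟨ cong sum (map-++ g (map suc (upTo n)) [ suc n ]) ⟩
  sum (map g (map suc (upTo n)) ++ [ g (suc n) ])
    ≡⟨ sum-++ (map g (map suc (upTo n))) [ g (suc n) ] ⟩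
  sumTo g n + (g (suc n) + 0)
    ≡⟨ cong (sumTo g n +_) (+-identityʳ _) ⟩
  sumTo g n + g (suc n) ∎
  where open ≡-Reasoning

sumTo-cong : ∀ g h n → (∀ i → 1 ≤ i → i ≤ n → g i ≡ h i) → sumTo g n ≡ sumTo h n
sumTo-cong g h zero eq = refl
sumTo-cong g h (suc n) eq = begin
  sumTo g (suc n)          ≡⟨ sumTo-suc g n ⟩
  sumTo g n + g (suc n)    ≡⟨ cong₂ _+_ (sumTo-cong g h n (λ i 1≤i i≤n → eq i 1≤i (m≤n⇒m≤1+n i≤n)))
                                         (eq (suc n) (s≤s z≤n) ≤-refl) ⟩
  sumTo h n + h (suc n)    ≡⟨ sym (sumTo-suc h n) ⟩
  sumTo h (suc n)          ∎
  where open ≡-Reasoning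

sumTo-vanish : ∀ g n → (∀ i → 1 ≤ i → i ≤ n → g i ≡ 0) → sumTo g n ≡ 0
sumTo-vanish g zero _ = refl
sumTo-vanish g (suc n) g≡0 = begin
  sumTo g (suc n)        ≡⟨ sumTo-suc g n ⟩
  sumTo g n + g (suc n)  ≡⟨ cong₂ _+_ (sumTo-vanish g n (λ i 1≤i i≤n → g≡0 i 1≤i (m≤n⇒m≤1+n i≤n)))
                                       (g≡0 (suc n) (s≤s z≤n) ≤-refl) ⟩
  0                      ∎
  where open ≡-Reasoning

sumTo-split : ∀ g a b → sumTo g (a + b) ≡ sumTo g a + sumTo (λ i → g (a + i)) b
sumTo-split g a zero = trans (cong (sumTo g) (+-identityʳ a)) (sym (+-identityʳ _))
sumTo-split g a (suc b) = begin
  sumTo g (a + suc b)                                            ≡⟨ cong (sumTo g) (+-suc a b) ⟩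
  sumTo g (suc (a + b))                                          ≡⟨ sumTo-suc g (a + b) ⟩
  sumTo g (a + b) + g (suc (a + b))                              ≡⟨ cong₂ _+_ (sumTo-split g a b) (cong g (sym (+-suc a b))) ⟩
  (sumTo g a + sumTo (λ i → g (a + i)) b) + g (a + suc b)        ≡⟨ +-assoc (sumTo g a) _ _ ⟩
  sumTo g a + (sumTo (λ i → g (a + i)) b + g (a + suc b))        ≡⟨ cong (sumTo g a +_) (sym (sumTo-suc (λ i → g (a + i)) b)) ⟩
  sumTo g a + sumTo (λ i → g (a + i)) (suc b)                    ∎
  where open ≡-Reasoning

sumTo-+ : ∀ g h n → sumTo (λ i → g i + h i) n ≡ sumTo g n + sumTo h n
sumTo-+ g h zero = refl
sumTo-+ g h (suc n) = begin
  sumTo (λ i → g i + h i) (suc n)                       ≡⟨ sumTo-suc _ n ⟩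
  sumTo (λ i → g i + h i) n + (g (suc n) + h (suc n))   ≡⟨ cong (_+ (g (suc n) + h (suc n))) (sumTo-+ g h n) ⟩
  (sumTo g n + sumTo h n) + (g (suc n) + h (suc n))     ≡⟨ +-interchange (sumTo g n) (sumTo h n) (g (suc n)) (h (suc n)) ⟩
  (sumTo g n + g (suc n)) + (sumTo h n + h (suc n))     ≡⟨ sym (cong₂ _+_ (sumTo-suc g n) (sumTo-suc h n)) ⟩
  sumTo g (suc n) + sumTo h (suc n)                     ∎
  where open ≡-Reasoning

sumTo-periodic : ∀ g n → (∀ i → g (n + i) ≡ g i) → ∀ q → sumTo g (q * n) ≡ q * sumTo g n
sumTo-periodic g n periodic zero = refl
sumTo-periodic g n periodic (suc q) = begin
  sumTo g (n + q * n)                            ≡⟨ sumTo-split g n (q * n) ⟩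
  sumTo g n + sumTo (λ i → g (n + i)) (q * n)    ≡⟨ cong (sumTo g n +_) (sumTo-cong _ g (q * n) (λ i _ _ → periodic i)) ⟩
  sumTo g n + sumTo g (q * n)                    ≡⟨ cong (sumTo g n +_) (sumTo-periodic g n periodic q) ⟩
  sumTo g n + q * sumTo g n                      ∎
  where open ≡-Reasoning

sumTo-multiples : ∀ g p → .{{NonZero p}} → (∀ k → p ∤ k → g k ≡ 0) →
  ∀ N → sumTo g (p * N) ≡ sumTo (λ j → g (p * j)) N
sumTo-multiples g p off zero = cong (sumTo g) (*-zeroʳ p)
sumTo-multiples g p@(suc p-1) off (suc N) = begin
  sumTo g (p * suc N)                                              ≡⟨ cong (sumTo g) (trans (*-suc p N) (+-comm p (p * N))) ⟩
  sumTo g (p * N + p)                                              ≡⟨ sumTo-split g (p * N) p ⟩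
  sumTo g (p * N) + sumTo (λ i → g (p * N + i)) (suc p-1)          ≡⟨ cong₂ _+_ (sumTo-multiples g p off N) (sumTo-suc _ p-1) ⟩
  G N + (sumTo (λ i → g (p * N + i)) p-1 + g (p * N + p))          ≡⟨ cong (λ s → G N + (s + g (p * N + p))) (sumTo-vanish _ p-1 between) ⟩
  G N + g (p * N + p)                                              ≡⟨ cong (λ k → G N + g k) (trans (+-comm (p * N) p) (sym (*-suc p N))) ⟩
  G N + g (p * suc N)                                              ≡⟨ sym (sumTo-suc _ N) ⟩
  G (suc N)                                                        ∎
  where
  open ≡-Reasoning
  G : ℕ → ℕ
  G = sumTo (λ j → g (p * j))
  -- strictly between p N and p (N + 1) there is no multiple of p
  between : ∀ i → 1 ≤ i → i ≤ p-1 → g (p * N + i) ≡ 0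
  between i 1≤i i≤p-1 = off _ (λ p∣pN+i →
    <⇒≱ (s≤s i≤p-1) (∣⇒≤ {{>-nonZero 1≤i}} (∣m+n∣m⇒∣n p∣pN+i (m∣m*n N))))

indicator : {P : ℕ → Set} → Decidable P → ℕ → ℕ
indicator P? x with P? x
... | yes _ = 1
... | no _ = 0

indicator-yes : {P : ℕ → Set} (P? : Decidable P) {x : ℕ} → P x → indicator P? x ≡ 1
indicator-yes P? {x} px with P? x
... | yes _ = refl
... | no ¬px = ⊥-elim (¬px px)

indicator-no : {P : ℕ → Set} (P? : Decidable P) {x : ℕ} → ¬ P x → indicator P? x ≡ 0
indicator-no P? {x} ¬px with P? x
... | yes px = ⊥-elim (¬px px)
... | no _ = refl

length-filter≡sum-indicator : {P : ℕ → Set} (P? : Decidable P) (xs : List ℕ) →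
  length (filter P? xs) ≡ sum (map (indicator P?) xs)
length-filter≡sum-indicator P? [] = refl
length-filter≡sum-indicator P? (x ∷ xs) with P? x
... | yes _ = cong suc (length-filter≡sum-indicator P? xs)
... | no _ = length-filter≡sum-indicator P? xs

χ : ℕ → ℕ → ℕ
χ n = indicator (λ k → gcd k n ≟ 1)

φ≡sumTo-χ : ∀ n → φ n ≡ sumTo (χ n) n
φ≡sumTo-χ n = length-filter≡sum-indicator (λ k → gcd k n ≟ 1) (range1 n)

χ-not-coprime : ∀ {n k} → ¬ Coprime k n → χ n k ≡ 0
χ-not-coprime {n} ¬c = indicator-no (λ k → gcd k n ≟ 1) (λ g≡1 → ¬c (gcd≡1⇒coprime g≡1))

χ-cong : ∀ {n m a b} → (Coprime a n → Coprime b m) → (Coprime b m → Coprime a n) → χ n a ≡ χ m b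
χ-cong {n} {m} {a} {b} to from with gcd a n ≟ 1 | gcd b m ≟ 1
... | yes _  | yes _  = refl
... | no _   | no _   = refl
... | yes g≡1 | no g≢1 = ⊥-elim (g≢1 (coprime⇒gcd≡1 (to (gcd≡1⇒coprime g≡1))))
... | no g≢1 | yes g≡1 = ⊥-elim (g≢1 (coprime⇒gcd≡1 (from (gcd≡1⇒coprime g≡1))))

χ-periodic : ∀ n i → χ n (n + i) ≡ χ n i
χ-periodic n i = χ-cong (λ c (d∣i , d∣n) → c (∣m∣n⇒∣m+n d∣n d∣i , d∣n))
                        (λ c (d∣n+i , d∣n) → c (∣m+n∣m⇒∣n d∣n+i d∣n , d∣n))

coprime-∣ˡ : ∀ {d k m} → d ∣ k → Coprime k m → Coprime d m
coprime-∣ˡ d∣k c (e∣d , e∣m) = c (∣-trans e∣d d∣k , e∣m)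

coprime-∣ʳ : ∀ {d k m} → d ∣ m → Coprime k m → Coprime k d
coprime-∣ʳ d∣m c (e∣k , e∣d) = c (e∣k , ∣-trans e∣d d∣m)

coprime-* : ∀ {k a b} → Coprime k a → Coprime k b → Coprime k (a * b)
coprime-* c-a c-b (d∣k , d∣ab) = c-b (d∣k , coprime-divisor (coprime-∣ˡ d∣k c-a) d∣ab)

prime≥2 : ∀ {p} → Prime p → 2 ≤ p
prime≥2 {p} pp = nonTrivial⇒n>1 p {{prime⇒nonTrivial pp}}

prime-∤⇒coprime : ∀ {p k} → Prime p → p ∤ k → Coprime k p
prime-∤⇒coprime pp p∤k (d∣k , d∣p) with prime⇒irreducible pp d∣p
... | inj₁ d≡1 = d≡1
... | inj₂ refl = ⊥-elim (p∤k d∣k)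

prime-∣⇒¬coprime : ∀ {p k} → Prime p → p ∣ k → ¬ Coprime k p
prime-∣⇒¬coprime pp p∣k c with c (p∣k , ∣-refl) | prime≥2 pp
... | refl | s≤s ()

φ-*-dividing : ∀ {p n} → Prime p → p ∣ n → φ (p * n) ≡ p * φ n
φ-*-dividing {p} {n} pp p∣n = begin
  φ (p * n)                ≡⟨ φ≡sumTo-χ (p * n) ⟩
  sumTo (χ (p * n)) (p * n) ≡⟨ sumTo-cong _ _ (p * n) (λ k _ _ → χ-cong
                                  (coprime-∣ʳ (n∣m*n p))
                                  (λ c → coprime-* (coprime-∣ʳ p∣n c) c)) ⟩
  sumTo (χ n) (p * n)      ≡⟨ sumTo-periodic (χ n) n (χ-periodic n) p ⟩
  p * sumTo (χ n) n        ≡⟨ cong (p *_) (sym (φ≡sumTo-χ n)) ⟩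
  p * φ n                  ∎
  where open ≡-Reasoning

-- φ (p n) + φ n = p φ n when the prime p does not divide n: among the p φ n residues in [1, p n]
-- coprime to n, exactly the φ n multiples of p fail to be coprime to p n
φ-*-coprime : ∀ {p n} → Prime p → p ∤ n → φ (p * n) + φ n ≡ p * φ n
φ-*-coprime {p} {n} pp p∤n = begin
  φ (p * n) + φ n                                  ≡⟨ cong₂ _+_ (φ≡sumTo-χ (p * n)) (sym sumTo-ψ) ⟩
  sumTo (χ (p * n)) (p * n) + sumTo ψ (p * n)      ≡⟨ sym (sumTo-+ _ _ (p * n)) ⟩
  sumTo (λ k → χ (p * n) k + ψ k) (p * n)          ≡⟨ sumTo-cong _ _ (p * n) (λ k _ _ → split k) ⟩
  sumTo (χ n) (p * n)                              ≡⟨ sumTo-periodic (χ n) n (χ-periodic n) p ⟩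
  p * sumTo (χ n) n                                ≡⟨ cong (p *_) (sym (φ≡sumTo-χ n)) ⟩
  p * φ n                                          ∎
  where
  open ≡-Reasoning
  instance _ = prime⇒nonZero pp
  ψ : ℕ → ℕ
  ψ k = indicator (p ∣?_) k * χ n k
  p-coprime-n : Coprime p n
  p-coprime-n = Coprime.sym (prime-∤⇒coprime pp p∤n)
  split : ∀ k → χ (p * n) k + ψ k ≡ χ n k
  split k with p ∣? k
  ... | yes p∣k = trans (cong (_+ (χ n k + 0)) (χ-not-coprime (λ c → prime-∣⇒¬coprime pp p∣k (coprime-∣ʳ (m∣m*n n) c))))
                        (+-identityʳ _)
  ... | no p∤k = trans (+-identityʳ _)
                       (χ-cong (coprime-∣ʳ (n∣m*n p)) (coprime-* (prime-∤⇒coprime pp p∤k)))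
  ψ-off : ∀ k → p ∤ k → ψ k ≡ 0
  ψ-off k p∤k = cong (_* χ n k) (indicator-no (p ∣?_) p∤k)
  ψ-multiple : ∀ j → ψ (p * j) ≡ χ n j
  ψ-multiple j = trans (cong (_* χ n (p * j)) (indicator-yes (p ∣?_) (m∣m*n j)))
    (trans (+-identityʳ _) (χ-cong
      (λ c (d∣j , d∣n) → c (∣n⇒∣m*n p d∣j , d∣n))
      (λ c (d∣pj , d∣n) → c (coprime-divisor (Coprime.sym (coprime-∣ʳ d∣n p-coprime-n)) d∣pj , d∣n))))
  sumTo-ψ : sumTo ψ (p * n) ≡ φ n
  sumTo-ψ = begin
    sumTo ψ (p * n)              ≡⟨ sumTo-multiples ψ p ψ-off n ⟩
    sumTo (λ j → ψ (p * j)) n    ≡⟨ sumTo-cong _ _ n (λ j _ _ → ψ-multiple j) ⟩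
    sumTo (χ n) n                ≡⟨ sym (φ≡sumTo-χ n) ⟩
    φ n                          ∎

-- 1 is coprime to every n, so φ n ≥ 1 for n ≥ 1
φ-pos : ∀ n → 1 ≤ n → 1 ≤ φ n
φ-pos (suc n) _ = subst (λ xs → 1 ≤ length xs)
  (sym (filter-accept (λ k → gcd k (suc n) ≟ 1) {x = 1} (gcd-zeroˡ (suc n)))) (s≤s z≤n)

∈-range1⁻ : ∀ {x n} → x ∈ range1 n → 1 ≤ x × x ≤ n
∈-range1⁻ x∈ with ∈-map⁻ suc x∈
... | y , y∈ , refl = s≤s z≤n , ∈-upTo⁻ y∈

∈-range1⁺ : ∀ {x n} → 1 ≤ x → x ≤ n → x ∈ range1 n
∈-range1⁺ {suc y} _ x≤n = ∈-map⁺ suc (∈-upTo⁺ x≤n)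

∈-divisors⁻ : ∀ {x n} → x ∈ divisors n → x ∣ n × 1 ≤ x
∈-divisors⁻ {n = n} x∈ with ∈-filter⁻ (_∣? n) {xs = range1 n} x∈
... | x∈range , x∣n = x∣n , proj₁ (∈-range1⁻ x∈range)

∈-divisors⁺ : ∀ {x n} → 1 ≤ n → x ∣ n → x ∈ divisors n
∈-divisors⁺ {zero} 1≤n 0∣n with 0∣⇒≡0 0∣n
... | refl = ⊥-elim (<⇒≱ 1≤n z≤n)
∈-divisors⁺ {suc x} {n} 1≤n x∣n = ∈-filter⁺ (_∣? n) (∈-range1⁺ (s≤s z≤n) (∣⇒≤ {{>-nonZero 1≤n}} x∣n)) x∣n

divisors-unique : ∀ n → Unique (divisors n)
divisors-unique n = Unique.filter⁺ (_∣? n) (Unique.map⁺ suc-injective (Unique.upTo⁺ n))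

sublist-unique : {xs ys : List ℕ} → xs ⊆ ys → Unique ys → Unique xs
sublist-unique [] u = u
sublist-unique (_ ∷ʳ xs⊆ys) (_ ∷ u) = sublist-unique xs⊆ys u
sublist-unique (refl ∷ xs⊆ys) (y∉ys ∷ u) = All-resp-⊆ xs⊆ys y∉ys ∷ sublist-unique xs⊆ys u

unique-same-elements⇒↭ : {xs ys : List ℕ} → Unique xs → Unique ys →
  (∀ {x} → x ∈ xs → x ∈ ys) → (∀ {x} → x ∈ ys → x ∈ xs) → xs ↭ ys
unique-same-elements⇒↭ u v to from = ∼bag⇒↭ (unique∧set⇒bag u v (mk⇔ to from))

sum-map-↭ : ∀ (f : ℕ → ℕ) {xs ys} → xs ↭ ys → sum (map f xs) ≡ sum (map f ys)
sum-map-↭ f xs↭ys = sum-↭ (Perm.map⁺ f xs↭ys)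

sum-map-⊆ : ∀ (f : ℕ → ℕ) {xs ys} → xs ⊆ ys → sum (map f xs) ≤ sum (map f ys)
sum-map-⊆ f [] = ≤-refl
sum-map-⊆ f {ys = y ∷ _} (_ ∷ʳ xs⊆ys) = ≤-trans (sum-map-⊆ f xs⊆ys) (m≤n+m _ (f y))
sum-map-⊆ f (refl ∷ xs⊆ys) = +-monoʳ-≤ _ (sum-map-⊆ f xs⊆ys)

sum-map-unique-≤ : ∀ (f : ℕ → ℕ) {xs ys} → Unique xs → Unique ys →
  (∀ {x} → x ∈ xs → x ∈ ys) → sum (map f xs) ≤ sum (map f ys)
sum-map-unique-≤ f {xs} {ys} uxs uys xs⊆ys = begin
  sum (map f xs)                  ≡⟨ sum-map-↭ f (unique-same-elements⇒↭ uxs (Unique.filter⁺ (_∈? xs) uys)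
                                       (λ x∈ → ∈-filter⁺ (_∈? xs) (xs⊆ys x∈) x∈)
                                       (λ x∈ → proj₂ (∈-filter⁻ (_∈? xs) {xs = ys} x∈))) ⟩
  sum (map f (filter (_∈? xs) ys)) ≤⟨ sum-map-⊆ f (filter-⊆ (_∈? xs) ys) ⟩
  sum (map f ys)                  ∎
  where open ≤-Reasoning

elem≤sum-map : ∀ (f : ℕ → ℕ) {x xs} → x ∈ xs → f x ≤ sum (map f xs)
elem≤sum-map f (here refl) = m≤m+n _ _
elem≤sum-map f {xs = y ∷ _} (there x∈) = ≤-trans (elem≤sum-map f x∈) (m≤n+m _ (f y))

sum-map-scale : ∀ (f g : ℕ → ℕ) c (xs : List ℕ) → (∀ {x} → x ∈ xs → f x ≡ c * g x) →
  sum (map f xs) ≡ c * sum (map g xs)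
sum-map-scale f g c [] _ = sym (*-zeroʳ c)
sum-map-scale f g c (x ∷ xs) f≡cg = trans (cong₂ _+_ (f≡cg (here refl)) (sum-map-scale f g c xs (f≡cg ∘ there)))
                                          (sym (*-distribˡ-+ c (g x) _))

_∤?_ : ∀ q → Decidable (q ∤_)
q ∤? d = ¬? (q ∣? d)

divisors-* : ∀ {q N} → Prime q → 1 ≤ N →
  divisors (q * N) ↭ map (q *_) (divisors N) ++ filter (q ∤?_) (divisors N)
divisors-* {q} {N} pq 1≤N = unique-same-elements⇒↭ (divisors-unique (q * N)) unique to from
  where
  instance _ = prime⇒nonZero pq
  1≤qN : 1 ≤ q * N
  1≤qN = ≤-trans 1≤N (m≤n*m N q)
  disjoint : ∀ {v} → v ∈ map (q *_) (divisors N) → v ∈ filter (q ∤?_) (divisors N) → ⊥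
  disjoint v∈ v∈′ with ∈-map⁻ (q *_) v∈
  ... | d , _ , refl = proj₂ (∈-filter⁻ (q ∤?_) {xs = divisors N} v∈′) (m∣m*n d)
  unique : Unique (map (q *_) (divisors N) ++ filter (q ∤?_) (divisors N))
  unique = Unique.++⁺ (Unique.map⁺ (*-cancelˡ-≡ _ _ q) (divisors-unique N))
                      (Unique.filter⁺ (q ∤?_) (divisors-unique N)) (λ (v∈ , v∈′) → disjoint v∈ v∈′)
  to : ∀ {x} → x ∈ divisors (q * N) → x ∈ map (q *_) (divisors N) ++ filter (q ∤?_) (divisors N)
  to {x} x∈ with ∈-divisors⁻ x∈ | q ∣? x
  ... | x∣qN , _ | yes (divides y refl) = ∈-++⁺ˡ (subst (_∈ map (q *_) (divisors N)) (*-comm q y)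
          (∈-map⁺ (q *_) (∈-divisors⁺ 1≤N (*-cancelˡ-∣ q (subst (_∣ q * N) (*-comm y q) x∣qN)))))
  ... | x∣qN , _ | no q∤x = ∈-++⁺ʳ (map (q *_) (divisors N))
          (∈-filter⁺ (q ∤?_) (∈-divisors⁺ 1≤N (coprime-divisor (prime-∤⇒coprime pq q∤x) x∣qN)) q∤x)
  from : ∀ {x} → x ∈ map (q *_) (divisors N) ++ filter (q ∤?_) (divisors N) → x ∈ divisors (q * N)
  from x∈ with ∈-++⁻ (map (q *_) (divisors N)) x∈
  ... | inj₁ x∈qD with ∈-map⁻ (q *_) x∈qD
  ...   | d , d∈ , refl = ∈-divisors⁺ 1≤qN (*-monoʳ-∣ q (proj₁ (∈-divisors⁻ d∈)))
  from x∈ | inj₂ x∈D′ = ∈-divisors⁺ 1≤qN (∣n⇒∣m*n q (proj₁ (∈-divisors⁻ (proj₁ (∈-filter⁻ (q ∤?_) {xs = divisors N} x∈D′)))))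

φ-*-sum : ∀ {q} → Prime q → ∀ (ds : List ℕ) →
  sum (map (λ d → φ (q * d)) ds) + sum (map φ (filter (q ∤?_) ds)) ≡ q * sum (map φ ds)
φ-*-sum {q} pq [] = sym (*-zeroʳ q)
φ-*-sum {q} pq (d ∷ ds) with q ∣? d
... | yes q∣d = begin
  (φ (q * d) + A) + B      ≡⟨ +-assoc (φ (q * d)) A B ⟩
  φ (q * d) + (A + B)      ≡⟨ cong₂ _+_ (φ-*-dividing pq q∣d) (φ-*-sum pq ds) ⟩
  q * φ d + q * sum (map φ ds) ≡⟨ sym (*-distribˡ-+ q (φ d) _) ⟩
  q * (φ d + sum (map φ ds)) ∎
  where
  open ≡-Reasoning
  A = sum (map (λ d → φ (q * d)) ds)
  B = sum (map φ (filter (q ∤?_) ds))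
... | no q∤d = begin
  (φ (q * d) + A) + (φ d + B)  ≡⟨ +-interchange (φ (q * d)) A (φ d) B ⟩
  (φ (q * d) + φ d) + (A + B)  ≡⟨ cong₂ _+_ (φ-*-coprime pq q∤d) (φ-*-sum pq ds) ⟩
  q * φ d + q * sum (map φ ds) ≡⟨ sym (*-distribˡ-+ q (φ d) _) ⟩
  q * (φ d + sum (map φ ds))   ∎
  where
  open ≡-Reasoning
  A = sum (map (λ d → φ (q * d)) ds)
  B = sum (map φ (filter (q ∤?_) ds))

Φ : ℕ → ℕ
Φ n = sum (map φ (divisors n))

Φ-*-prime : ∀ {q N} → Prime q → 1 ≤ N → Φ (q * N) ≡ q * Φ N
Φ-*-prime {q} {N} pq 1≤N = begin
  Φ (q * N)                                         ≡⟨ sum-map-↭ φ (divisors-* pq 1≤N) ⟩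
  sum (map φ (map (q *_) Ds ++ filter (q ∤?_) Ds))  ≡⟨ cong sum (map-++ φ (map (q *_) Ds) _) ⟩
  sum (map φ (map (q *_) Ds) ++ map φ (filter (q ∤?_) Ds))
                                                    ≡⟨ sum-++ (map φ (map (q *_) Ds)) _ ⟩
  sum (map φ (map (q *_) Ds)) + sum (map φ (filter (q ∤?_) Ds))
                                                    ≡⟨ cong (λ l → sum l + sum (map φ (filter (q ∤?_) Ds))) (sym (map-∘ Ds)) ⟩
  sum (map (λ d → φ (q * d)) Ds) + sum (map φ (filter (q ∤?_) Ds))
                                                    ≡⟨ φ-*-sum pq Ds ⟩
  q * Φ N                                           ∎
  where
  open ≡-Reasoning
  Ds = divisors N

gauss : ∀ n → 1 ≤ n → Φ n ≡ n
gauss n 1≤n = subst (λ m → Φ m ≡ m) (sym (PrimeFactorisation.isFactorisation F))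
                    (Φ-product (PrimeFactorisation.factors F) (PrimeFactorisation.factorsPrime F))
  where
  instance _ = >-nonZero 1≤n
  F = factorise n
  Φ-product : ∀ qs → All Prime qs → Φ (product qs) ≡ product qs
  Φ-product [] [] = refl
  Φ-product (q ∷ qs) (pq ∷ pqs) = trans (Φ-*-prime pq (productOfPrimes≥1 pqs)) (cong (q *_) (Φ-product qs pqs))

φ-*-coprime′ : ∀ {p′ n} → Prime (suc p′) → suc p′ ∤ n → φ (suc p′ * n) ≡ p′ * φ n
φ-*-coprime′ {p′} {n} pp p∤n = +-cancelʳ-≡ (φ n) _ _ (trans (φ-*-coprime pp p∤n) (+-comm (φ n) (p′ * φ n)))

φ-*-lower : ∀ {p′} → Prime (suc p′) → ∀ n → p′ * φ n ≤ φ (suc p′ * n)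
φ-*-lower {p′} pp n with suc p′ ∣? n
... | yes p∣n = subst (p′ * φ n ≤_) (sym (φ-*-dividing pp p∣n)) (m≤n+m _ (φ n))
... | no p∤n = ≤-reflexive (sym (φ-*-coprime′ pp p∤n))

φ-prime-power : ∀ {p′ d} → Prime (suc p′) → suc p′ ∤ d → ∀ j →
  φ (suc p′ ^ suc j * d) ≡ p′ * suc p′ ^ j * φ d
φ-prime-power {p′} {d} pp p∤d zero = begin
  φ (suc p′ ^ 1 * d)   ≡⟨ cong (λ z → φ (z * d)) (*-identityʳ (suc p′)) ⟩
  φ (suc p′ * d)       ≡⟨ φ-*-coprime′ pp p∤d ⟩
  p′ * φ d             ≡⟨ cong (_* φ d) (sym (*-identityʳ p′)) ⟩
  p′ * 1 * φ d         ∎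
  where open ≡-Reasoning
φ-prime-power {p′} {d} pp p∤d (suc j) = begin
  φ (p * p ^ suc j * d)       ≡⟨ cong φ (*-assoc p (p ^ suc j) d) ⟩
  φ (p * (p ^ suc j * d))     ≡⟨ φ-*-dividing pp (∣m⇒∣m*n d (m∣m*n (p ^ j))) ⟩
  p * φ (p ^ suc j * d)       ≡⟨ cong (p *_) (φ-prime-power pp p∤d j) ⟩
  p * (p′ * p ^ j * φ d)      ≡⟨ rearrange p p′ (p ^ j) (φ d) ⟩
  p′ * (p * p ^ j) * φ d      ∎
  where
  open ≡-Reasoning
  p = suc p′
  rearrange : ∀ a b c e → a * (b * c * e) ≡ b * (a * c) * e
  rearrange = solve-∀

φ-multiple-lower : ∀ {p′ x} → Prime (suc p′) → 1 ≤ x → suc p′ ∣ x → p′ ≤ φ x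
φ-multiple-lower {p′} pp 1≤x (divides zero refl) = ⊥-elim (<⇒≱ 1≤x z≤n)
φ-multiple-lower {p′} pp _ (divides w@(suc _) refl) = begin
  p′                  ≡⟨ sym (*-identityʳ p′) ⟩
  p′ * 1              ≤⟨ *-monoʳ-≤ p′ (φ-pos w (s≤s z≤n)) ⟩
  p′ * φ w            ≤⟨ φ-*-lower pp w ⟩
  φ (suc p′ * w)      ≡⟨ cong φ (*-comm (suc p′) w) ⟩
  φ (w * suc p′)      ∎
  where open ≤-Reasoning

φ-multiple²-lower : ∀ {p′ x} → Prime (suc p′) → 1 ≤ x → suc p′ * suc p′ ∣ x → suc p′ * p′ ≤ φ x
φ-multiple²-lower {p′} pp 1≤x (divides zero refl) = ⊥-elim (<⇒≱ 1≤x z≤n)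
φ-multiple²-lower {p′} pp _ (divides w@(suc _) refl) = begin
  p * p′             ≤⟨ *-monoʳ-≤ p (φ-multiple-lower pp (≤-trans (s≤s z≤n) (m≤n*m w p)) (m∣m*n w)) ⟩
  p * φ (p * w)      ≡⟨ sym (φ-*-dividing pp (m∣m*n w)) ⟩
  φ (p * (p * w))    ≡⟨ cong φ (rearrange w p) ⟩
  φ (w * (p * p))    ∎
  where
  open ≤-Reasoning
  p = suc p′
  rearrange : ∀ w p → p * (p * w) ≡ w * (p * p)
  rearrange = solve-∀

Representable : ℕ → ℕ → Set
Representable n m = Σ (List ℕ) λ L → Unique L × (∀ {x} → x ∈ L → x ∣ n) × sum (map φ L) ≡ m

AllRepresentable : ℕ → Set
AllRepresentable n = ∀ m → m ≤ n → Representable n m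

practical⇒allRepresentable : ∀ n → φ-practical n → AllRepresentable n
practical⇒allRepresentable n _ zero _ = [] , [] , (λ ()) , refl
practical⇒allRepresentable n prac (suc m) m≤n with prac (suc m) (s≤s z≤n) m≤n
... | D , D⊆ , sumD = D , sublist-unique D⊆ (divisors-unique n) , (λ x∈ → proj₁ (∈-divisors⁻ (Any-resp-⊆ D⊆ x∈))) , sumD

-- a representation is turned into a sublist of `divisors n` by filtering that list
allRepresentable⇒practical : ∀ n → 1 ≤ n → AllRepresentable n → φ-practical n
allRepresentable⇒practical n 1≤n rep m _ m≤n with rep m m≤n
... | L , uL , L∣n , sumL = filter (_∈? L) (divisors n) , filter-⊆ (_∈? L) (divisors n) ,
  trans (sum-map-↭ φ (unique-same-elements⇒↭ (Unique.filter⁺ (_∈? L) (divisors-unique n)) uL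
           (λ x∈ → proj₂ (∈-filter⁻ (_∈? L) {xs = divisors n} x∈))
           (λ x∈ → ∈-filter⁺ (_∈? L) (∈-divisors⁺ 1≤n (L∣n x∈)) x∈)))
        sumL

decompose : ∀ A c B m → c ≤ A + 1 → m ≤ A + c * B →
  Σ ℕ λ r → Σ ℕ λ b → r ≤ A × b ≤ B × m ≡ r + c * b
decompose A c zero m _ m≤A+c0 = m , 0 , subst (m ≤_) (trans (cong (A +_) (*-zeroʳ c)) (+-identityʳ A)) m≤A+c0 , z≤n ,
  sym (trans (cong (m +_) (*-zeroʳ c)) (+-identityʳ m))
decompose A c (suc B) m c≤A+1 m≤ with m ≤? A + c * B
... | yes m≤′ with decompose A c B m c≤A+1 m≤′
...   | r , b , r≤A , b≤B , m≡ = r , b , r≤A , m≤n⇒m≤1+n b≤B , m≡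
decompose A c (suc B) m c≤A+1 m≤ | no m≰ = m ∸ c * suc B , suc B , r≤A , ≤-refl , sym (m∸n+n≡m cB≤m)
  where
  cB≤m : c * suc B ≤ m
  cB≤m = begin
    c * suc B            ≡⟨ *-suc c B ⟩
    c + c * B            ≤⟨ +-monoˡ-≤ (c * B) c≤A+1 ⟩
    A + 1 + c * B        ≡⟨ trans (+-assoc A 1 (c * B)) (+-suc A (c * B)) ⟩
    suc (A + c * B)      ≤⟨ ≰⇒> m≰ ⟩
    m                    ∎
    where open ≤-Reasoning
  r≤A : m ∸ c * suc B ≤ A
  r≤A = subst (m ∸ c * suc B ≤_) (m+n∸n≡m A (c * suc B)) (∸-monoˡ-≤ (c * suc B) m≤)

-- A set D of divisors of n either avoids the multiples of q, and then
-- Σ_D φ ≤ Σ_{d ∣ N} φ d = N by Gauss, or contains one, and then Σ_D φ ≥ c.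
φ-sum-gap : ∀ {n q N c} {D : List ℕ} → 1 ≤ N → D ⊆ divisors n →
  (∀ {x} → x ∣ n → q ∤ x → x ∣ N) → (∀ {x} → 1 ≤ x → q ∣ x → c ≤ φ x) →
  sum (map φ D) ≤ N ⊎ c ≤ sum (map φ D)
φ-sum-gap {n} {q} {N} {c} {D} 1≤N D⊆ ∤⇒∣N ∣⇒c≤φ with any? (q ∣?_) D
... | yes some = let x , x∈ , q∣x = find some in
  inj₂ (≤-trans (∣⇒c≤φ (proj₂ (∈-divisors⁻ {n = n} (Any-resp-⊆ D⊆ x∈))) q∣x) (elem≤sum-map φ x∈))
... | no none = inj₁ (subst (sum (map φ D) ≤_) (gauss N 1≤N)
  (sum-map-unique-≤ φ (sublist-unique D⊆ (divisors-unique n)) (divisors-unique N)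
    (λ x∈ → ∈-divisors⁺ 1≤N (∤⇒∣N (proj₁ (∈-divisors⁻ (Any-resp-⊆ D⊆ x∈))) (λ q∣x → none (lose x∈ q∣x))))))

∤-∣-power : ∀ {p x M} → Prime p → p ∤ x → ∀ k → x ∣ p ^ k * M → x ∣ M
∤-∣-power {p} {x} {M} pp p∤x zero x∣ = subst (x ∣_) (*-identityˡ M) x∣
∤-∣-power {p} {x} {M} pp p∤x (suc k) x∣ =
  ∤-∣-power pp p∤x k (coprime-divisor (prime-∤⇒coprime pp p∤x) (subst (x ∣_) (*-assoc p (p ^ k) M) x∣))

p²∤-∣-power : ∀ {p x M} → Prime p → p * p ∤ x → ∀ k → x ∣ p ^ suc k * M → x ∣ p * M
p²∤-∣-power {p} {x} {M} pp p²∤x k x∣ with p ∣? x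
... | no p∤x = ∣n⇒∣m*n p (∤-∣-power pp p∤x (suc k) x∣)
... | yes (divides z refl) = subst (_∣ p * M) (*-comm p z) (*-monoʳ-∣ p (∤-∣-power pp p∤z k z∣))
  where
  instance _ = prime⇒nonZero pp
  p∤z : p ∤ z
  p∤z p∣z = p²∤x (*-monoˡ-∣ p p∣z)
  z∣ : z ∣ p ^ k * M
  z∣ = *-cancelˡ-∣ p (subst₂ _∣_ (*-comm z p) (*-assoc p (p ^ k) M) x∣)

module PrimeExtension {p′ M : ℕ} (pp : Prime (suc p′)) (p∤M : suc p′ ∤ M) where

  private
    p = suc p′

  representable-combine : ∀ j {r b} → Representable (p ^ j * M) r → Representable M b →
    Representable (p ^ suc j * M) (r + p′ * p ^ j * b)
  representable-combine j {r} {b} (L₁ , u₁ , L₁∣ , sum₁) (L₂ , u₂ , L₂∣ , sum₂) =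
    L₁ ++ map (q *_) L₂ , unique , divides-p^[1+j]M , sum-φ
    where
    q = p ^ suc j
    instance
      _ = m^n≢0 p (suc j)
      _ = m^n≢0 p j
    p∤L₂ : ∀ {d} → d ∈ L₂ → p ∤ d
    p∤L₂ d∈ p∣d = p∤M (∣-trans p∣d (L₂∣ d∈))
    -- q d ∣ p^j M would force p d ∣ M
    disjoint : ∀ {v} → v ∈ L₁ → v ∈ map (q *_) L₂ → ⊥
    disjoint v∈L₁ v∈qL₂ with ∈-map⁻ (q *_) v∈qL₂
    ... | d , _ , refl = p∤M (∣-trans (m∣m*n d)
            (*-cancelˡ-∣ (p ^ j) (subst (_∣ p ^ j * M) (reassoc p (p ^ j) d) (L₁∣ v∈L₁))))
      where
      reassoc : ∀ a x d → a * x * d ≡ x * (a * d)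
      reassoc = solve-∀
    unique : Unique (L₁ ++ map (q *_) L₂)
    unique = Unique.++⁺ u₁ (Unique.map⁺ (*-cancelˡ-≡ _ _ q) u₂) (λ (v∈L₁ , v∈qL₂) → disjoint v∈L₁ v∈qL₂)
    divides-p^[1+j]M : ∀ {x} → x ∈ L₁ ++ map (q *_) L₂ → x ∣ q * M
    divides-p^[1+j]M {x} x∈ with ∈-++⁻ L₁ x∈
    ... | inj₁ x∈L₁ = subst (x ∣_) (sym (*-assoc p (p ^ j) M)) (∣n⇒∣m*n p (L₁∣ x∈L₁))
    ... | inj₂ x∈qL₂ with ∈-map⁻ (q *_) x∈qL₂
    ...   | d , d∈ , refl = *-monoʳ-∣ q (L₂∣ d∈)
    sum-φ : sum (map φ (L₁ ++ map (q *_) L₂)) ≡ r + p′ * p ^ j * b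
    sum-φ = begin
      sum (map φ (L₁ ++ map (q *_) L₂))               ≡⟨ cong sum (map-++ φ L₁ _) ⟩
      sum (map φ L₁ ++ map φ (map (q *_) L₂))         ≡⟨ sum-++ (map φ L₁) _ ⟩
      sum (map φ L₁) + sum (map φ (map (q *_) L₂))    ≡⟨ cong₂ _+_ sum₁ (cong sum (sym (map-∘ L₂))) ⟩
      r + sum (map (λ d → φ (q * d)) L₂)              ≡⟨ cong (r +_) (sum-map-scale _ φ (p′ * p ^ j) L₂
                                                           (λ d∈ → φ-prime-power pp (p∤L₂ d∈) j)) ⟩
      r + p′ * p ^ j * sum (map φ L₂)                 ≡⟨ cong (λ s → r + p′ * p ^ j * s) sum₂ ⟩
      r + p′ * p ^ j * b                              ∎
      where open ≡-Reasoning

  -- the inductive step: p^(j+1) M = p^j M + φ (p^(j+1)) M, so by `decompose` every m ≤ p^(j+1) M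
  -- splits as r + φ (p^(j+1)) b provided φ (p^(j+1)) ≤ p^j M + 1
  allRepresentable-step : AllRepresentable M → ∀ j → p′ * p ^ j ≤ p ^ j * M + 1 →
    AllRepresentable (p ^ j * M) → AllRepresentable (p ^ suc j * M)
  allRepresentable-step repM j small rep m m≤
    with decompose (p ^ j * M) (p′ * p ^ j) M m small (subst (m ≤_) (split-power p′ (p ^ j) M) m≤)
    where
    split-power : ∀ a x m → (suc a * x) * m ≡ x * m + a * x * m
    split-power = solve-∀
  ... | r , b , r≤ , b≤ , refl = representable-combine j (rep r r≤) (repM b b≤)

  -- Sufficiency for p M: one extension step from M, whose condition p′ ≤ M + 1 is p ≤ M + 2
  practical-pM : 1 ≤ M → φ-practical M → p ≤ M + 2 → φ-practical (p * M)
  practical-pM 1≤M prac p≤M+2 = allRepresentable⇒practical (p * M) (≤-trans 1≤M (m≤n*m M p))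
    (subst AllRepresentable (cong (_* M) (*-identityʳ p))
      (allRepresentable-step repM 0 small (subst AllRepresentable (sym (*-identityˡ M)) repM)))
    where
    repM = practical⇒allRepresentable M prac
    small : p′ * 1 ≤ 1 * M + 1
    small rewrite *-identityʳ p′ | *-identityˡ M = ≤-pred (subst (p ≤_) (+-suc M 1) p≤M+2)

  -- Sufficiency for p^k M: when p′ ≤ M every extension step p^j M ↦ p^(j+1) M applies
  allRepresentable-powers : φ-practical M → p′ ≤ M → ∀ j → AllRepresentable (p ^ j * M)
  allRepresentable-powers prac p′≤M zero = subst AllRepresentable (sym (*-identityˡ M)) (practical⇒allRepresentable M prac)
  allRepresentable-powers prac p′≤M (suc j) =
    allRepresentable-step (practical⇒allRepresentable M prac) j small (allRepresentable-powers prac p′≤M j)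
    where
    small : p′ * p ^ j ≤ p ^ j * M + 1
    small = ≤-trans (≤-trans (*-monoˡ-≤ (p ^ j) p′≤M) (≤-reflexive (*-comm M (p ^ j)))) (m≤m+n _ 1)

  practical-p^kM : 1 ≤ M → φ-practical M → p ≤ M + 1 → ∀ k → φ-practical (p ^ k * M)
  practical-p^kM 1≤M prac p≤M+1 k = allRepresentable⇒practical _ (*-mono-≤ (m^n>0 p k) 1≤M)
    (allRepresentable-powers prac (≤-pred (subst (p ≤_) (+-comm M 1) p≤M+1)) k)

  -- Necessity for p M: if p > M + 2, then M + 1 is not a φ-sum of divisors of p M, since
  -- such sums are ≤ M or ≥ φ (p) = p′ (gap lemma with q = p, N = M)
  not-practical-pM : 1 ≤ M → M + 2 < p → ¬ φ-practical (p * M)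
  not-practical-pM 1≤M (s≤s M+2≤p′) prac = excluded (prac (M + 1) (m≤n+m 1 M) (+-monoʳ-≤ M 1≤p′M))
    where
    1≤p′M : 1 ≤ p′ * M
    1≤p′M = *-mono-≤ (≤-trans (s≤s z≤n) (≤-trans (m≤n+m 2 M) M+2≤p′)) 1≤M
    excluded : ¬ Σ (List ℕ) (λ D → D ⊆ divisors (p * M) × sum (map φ D) ≡ M + 1)
    excluded (D , D⊆ , sumD)
      with φ-sum-gap 1≤M D⊆ (λ x∣pM p∤x → coprime-divisor (prime-∤⇒coprime pp p∤x) x∣pM) (φ-multiple-lower pp)
    ... | inj₁ sum≤M = <⇒≱ (≤-reflexive (trans (+-comm 1 M) (sym sumD))) sum≤M
    ... | inj₂ p′≤sum = <⇒≱ (≤-trans (≤-reflexive (sym (+-suc M 1))) M+2≤p′) (subst (p′ ≤_) sumD p′≤sum)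

  -- Necessity for p^k M, k ≥ 2: if p > M + 1, then t = p′ (M + 1) is not a φ-sum of divisors of p^k M,
  -- since such sums are ≤ p M or ≥ φ (p²) = p p′ (gap lemma with q = p², N = p M), while p M < t < p p′
  not-practical-p^kM : 1 ≤ M → M + 1 < p → ∀ k → 2 ≤ k → ¬ φ-practical (p ^ k * M)
  not-practical-p^kM _ _ (suc zero) (s≤s ())
  not-practical-p^kM 1≤M (s≤s M+1≤p′) (suc (suc k)) _ prac = excluded (prac t 1≤t t≤p^kM)
    where
    instance _ = >-nonZero (≤-trans (m≤n+m 1 M) M+1≤p′)
    1≤p′ : 1 ≤ p′
    1≤p′ = ≤-trans (m≤n+m 1 M) M+1≤p′
    t = p′ * (M + 1)
    1≤t : 1 ≤ t
    1≤t = *-mono-≤ 1≤p′ (m≤n+m 1 M)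
    t≤p^kM : t ≤ p ^ suc (suc k) * M
    t≤p^kM = begin
      p′ * (M + 1)           ≤⟨ *-mono-≤ (n≤1+n p′) (+-monoʳ-≤ M (*-mono-≤ 1≤p′ 1≤M)) ⟩
      p * (M + p′ * M)       ≡⟨ reassoc p′ M ⟩
      p * (p * 1) * M        ≤⟨ *-monoˡ-≤ M (*-monoʳ-≤ p (*-monoʳ-≤ p (m^n>0 p k))) ⟩
      p * (p * p ^ k) * M    ∎
      where
      open ≤-Reasoning
      reassoc : ∀ a M → suc a * (M + a * M) ≡ suc a * (suc a * 1) * M
      reassoc = solve-∀
    pM<t : p * M < t
    pM<t = begin-strict
      M + p′ * M       <⟨ +-monoˡ-< (p′ * M) (subst (_≤ p′) (+-comm M 1) M+1≤p′) ⟩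
      p′ + p′ * M      ≡⟨ sym (*-suc p′ M) ⟩
      p′ * suc M       ≡⟨ cong (p′ *_) (+-comm 1 M) ⟩
      p′ * (M + 1)     ∎
      where open ≤-Reasoning
    t<pp′ : t < p * p′
    t<pp′ = begin-strict
      p′ * (M + 1)     <⟨ *-monoʳ-< p′ (s≤s M+1≤p′) ⟩
      p′ * p           ≡⟨ *-comm p′ p ⟩
      p * p′           ∎
      where open ≤-Reasoning
    excluded : ¬ Σ (List ℕ) (λ D → D ⊆ divisors (p ^ suc (suc k) * M) × sum (map φ D) ≡ t)
    excluded (D , D⊆ , sumD)
      with φ-sum-gap (≤-trans 1≤M (m≤n*m M p)) D⊆ (λ x∣ p²∤x → p²∤-∣-power pp p²∤x (suc k) x∣) (φ-multiple²-lower pp)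
    ... | inj₁ sum≤pM = <⇒≱ pM<t (subst (_≤ p * M) sumD sum≤pM)
    ... | inj₂ pp′≤sum = <⇒≱ t<pp′ (subst (p * p′ ≤_) sumD pp′≤sum)

lemma4p1 : (M p : ℕ) → 1 ≤ M → φ-practical M → Prime p → Coprime p M →
    (φ-practical (p * M) ⇔ p ≤ M + 2) ×
    ((k : ℕ) → 2 ≤ k → (φ-practical (p ^ k * M) ⇔ p ≤ M + 1))
lemma4p1 M zero _ _ pp _ = ⊥-elim (¬prime[0] pp)
lemma4p1 M (suc p′) 1≤M prac pp coprime =
  mk⇔ (λ prac-pM → ≮⇒≥ (λ p>M+2 → not-practical-pM 1≤M p>M+2 prac-pM))
      (practical-pM 1≤M prac) ,
  λ k 2≤k → mk⇔ (λ prac-p^kM → ≮⇒≥ (λ p>M+1 → not-practical-p^kM 1≤M p>M+1 k 2≤k prac-p^kM))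
                (λ p≤M+1 → practical-p^kM 1≤M prac p≤M+1 k)
  where
  p∤M : suc p′ ∤ M
  p∤M p∣M = prime-∣⇒¬coprime pp p∣M (Coprime.sym coprime)
  open PrimeExtension pp p∤M
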